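{- Let $G=K_{n_1,n_2,\dots,n_t}$ be a complete multipartite graph with $t>2$ parts and $n_i\ge 2$ for all $i=1,\dots,t$. Then $G$ is a $\mathcal{P}$ position of Grim if and only if $|V(G)|=n_1+\cdots+n_t$ is even.
   Context: Grim: two players alternate moves on a finite simple undirected graph. Before play, isolated vertices are deleted. A move consists of choosing a remaining vertex and deleting it together with its incident edges, and then deleting every vertex that has become isolated. The player making the last move wins (a player with no available move loses). A graph is an $\mathcal{N}$ position if the player about to move has a winning strategy, and a $\mathcal{P}$ position otherwise. -}

module Defs where

open import Data.Bool using (Bool; true; false; _∧_; not)
open import Data.Nat using (ℕ; _≡ᵇ_)
open import Data.Fin using (Fin)
open import Data.List using (List; []; _∷_; length; replicate; _++_; lookup)
open import Data.Vec using (Vec; tabulate)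
import Data.Vec as Vec
import Data.Nat as ℕ
import Relation.Binary.PropositionalEquality
import Data.Bool
import Data.Empty
open import Data.Fin.Subset using (Subset; _∈_; _-_; ⊤; inside; outside)
open import Data.Fin.Properties using (_≟_; any?)
open import Relation.Nullary using (does)
open import Relation.Binary.PropositionalEquality using (_≡_)
open import Data.Product using (∃; _×_)

record Graph (n : ℕ) : Set where
  field
    adj   : Fin n → Fin n → Bool
    sym   : ∀ u v → adj u v ≡ adj v u
    irrefl : ∀ v → adj v v ≡ false
open Graph public

-- Grim on a fixed graph.  A position is the set of remaining vertices
-- (the induced subgraph on it is the current graph).

mem : ∀ {n} → Subset n → Fin n → Bool
mem S v = Vec.lookup S v

hasNbr : ∀ {n} → Graph n → Subset n → Fin n → Bool
hasNbr G S v = does (any? λ u → Data.Bool._≟_ (mem S u ∧ adj G v u) true)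
  where import Data.Bool

clean : ∀ {n} → Graph n → Subset n → Subset n
clean G S = tabulate λ v → mem S v ∧ hasNbr G S v

start : ∀ {n} → Graph n → Subset n
start G = clean G ⊤

move : ∀ {n} → Graph n → Subset n → Fin n → Subset n
move G S v = clean G (S - v)

-- The player about to move in position S has a winning strategy
-- (normal play: last mover wins).
data Win {n} (G : Graph n) (S : Subset n) : Set where
  win : (v : Fin n) → v ∈ S →
        (∀ w → w ∈ move G S v → Win G (move G (move G S v) w)) →
        Win G S

IsN : ∀ {n} → Graph n → Set
IsN G = Win G (start G)

IsP : ∀ {n} → Graph n → Set
IsP G = Win G (start G) → Data.Empty.⊥
  where import Data.Empty

-- Vertices are Fin (length (labels ns)) (= Fin (n_1+...+n_t)); vertex k
-- belongs to the part  label k ; two vertices are adjacent iff they lie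
-- in different parts.

labelsFrom : ℕ → List ℕ → List ℕ
labelsFrom i []       = []
labelsFrom i (m ∷ ms) = replicate m i ++ labelsFrom (ℕ.suc i) ms
  where import Data.Nat as ℕ

labels : List ℕ → List ℕ
labels = labelsFrom 0

numVertices : List ℕ → ℕ
numVertices ns = length (labels ns)

private
  sameᵇ-sym : ∀ a b → (a ≡ᵇ b) ≡ (b ≡ᵇ a)
  sameᵇ-sym ℕ.zero ℕ.zero = Relation.Binary.PropositionalEquality.refl
  sameᵇ-sym ℕ.zero (ℕ.suc b) = Relation.Binary.PropositionalEquality.refl
  sameᵇ-sym (ℕ.suc a) ℕ.zero = Relation.Binary.PropositionalEquality.refl
  sameᵇ-sym (ℕ.suc a) (ℕ.suc b) = sameᵇ-sym a b
  sameᵇ-refl : ∀ a → (a ≡ᵇ a) ≡ true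
  sameᵇ-refl ℕ.zero = Relation.Binary.PropositionalEquality.refl
  sameᵇ-refl (ℕ.suc a) = sameᵇ-refl a

CompleteMultipartite : (ns : List ℕ) → Graph (numVertices ns)
CompleteMultipartite ns = record
  { adj = λ u v → not (lookup (labels ns) u ≡ᵇ lookup (labels ns) v)
  ; sym = λ u v → Relation.Binary.PropositionalEquality.cong not
                    (sameᵇ-sym (lookup (labels ns) u) (lookup (labels ns) v))
  ; irrefl = λ v → Relation.Binary.PropositionalEquality.cong not
                    (sameᵇ-refl (lookup (labels ns) v))
  }

-- Call a set of vertices paired if it meets every part in zero or at least two
-- vertices, and balanced if moreover it meets two parts, so that no vertex of it
-- is isolated. In an even balanced position every move v leaves an odd position
-- in which only a partner p of v can be alone in its part. From such a position
-- the mover restores a paired position: remove p if it is alone, and otherwise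
-- a vertex from a part of size at least three, which exists because a position
-- meeting every part in exactly two vertices is even. What is left is either
-- balanced and even again or has no edge at all, in which case the mover made
-- the last move. So even balanced positions are P-positions, and the paired odd
-- ones are N-positions.

module Submission where

open import Defs hiding (sym)
open import Data.Bool using (true; false; not; _∧_)
open import Data.Bool.Properties using (∧-conicalˡ; ∧-conicalʳ)
open import Data.Empty using (⊥-elim)
open import Data.Fin using (Fin; zero; suc)
open import Data.Fin.Properties using (any?; suc-injective) renaming (_≟_ to _≟ᶠ_)
open import Data.Fin.Subset using (Subset; _∈_; _∉_; _⊆_; _-_; ∣_∣; ⊤; ⁅_⁆; Empty)
open import Data.Fin.Subset.Properties
  using (_∈?_; ∈⊤; ∣⊤∣≡n; ∣⊥∣≡0; p─⊥≡p; p─q⊆p; x∈p∧x≢y⇒x∈p-y; x∈p⇒∣p-x∣<∣p∣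
        ; nonempty?; Empty-unique)
open import Data.List using (List; []; _∷_; length; replicate; _++_; lookup)
open import Data.List.Properties using (length-++; length-replicate)
open import Data.List.Relation.Unary.All using (All; []; _∷_)
open import Data.List.Relation.Unary.Any using (Any; here; index)
open import Data.List.Relation.Unary.Any.Properties using (lookup-index; ++⁺ʳ)
open import Data.Nat using (ℕ; zero; suc; _+_; _<_; _≤_; _≟_; s≤s)
open import Data.Nat.Divisibility using (_∣_; _∤_; _∣?_; _∣0; ∣-refl; ∣m∣n⇒∣m+n; ∣m+n∣m⇒∣n; ∣1⇒≡1)
open import Data.Nat.Induction using (<-wellFounded)
open import Data.Nat.ListAction using (sum)
open import Data.Nat.Properties using (+-comm; <-trans; 0≢1+n)
open import Data.Product using (∃; _×_; _,_; proj₁; proj₂)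
open import Data.Sum using (_⊎_; inj₁; inj₂)
open import Data.Vec using (_∷_; here; there; tabulate)
open import Data.Vec.Properties
  using (tabulate-cong; tabulate∘lookup; lookup∘tabulate; []=⇒lookup; lookup⇒[]=)
open import Function using (_∘_)
open import Function.Bundles using (_⇔_; mk⇔)
open import Induction.WellFounded using (Acc; acc)
open import Relation.Nullary using (¬_; Dec; yes; no; does)
open import Relation.Nullary.Decidable using (dec-true; dec-false; _×-dec_; ¬?; decidable-stable)
open import Relation.Binary.PropositionalEquality
  using (_≡_; _≢_; refl; sym; trans; cong; cong₂; subst; module ≡-Reasoning)

2∣1+n⇒2∤n : ∀ {n} → 2 ∣ suc n → 2 ∤ n
2∣1+n⇒2∤n {n} 2∣1+n 2∣n
  with () ← ∣1⇒≡1 (∣m+n∣m⇒∣n (subst (2 ∣_) (+-comm 1 n) 2∣1+n) 2∣n)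

2∤1+n⇒2∣n : ∀ {n} → 2 ∤ suc n → 2 ∣ n
2∤1+n⇒2∣n {zero}        _    = 2 ∣0
2∤1+n⇒2∣n {suc zero}    2∤2  = ⊥-elim (2∤2 ∣-refl)
2∤1+n⇒2∣n {suc (suc n)} 2∤3+n =
  ∣m∣n⇒∣m+n ∣-refl (2∤1+n⇒2∣n (2∤3+n ∘ ∣m∣n⇒∣m+n ∣-refl))

does≡true⇒ : ∀ {a} {A : Set a} (a? : Dec A) → does a? ≡ true → A
does≡true⇒ (yes a) _  = a
does≡true⇒ (no _)  ()

x∉p-x : ∀ {n} (p : Subset n) x → x ∉ p - x
x∉p-x (true ∷ p)  zero    ()
x∉p-x (false ∷ p) zero    ()
x∉p-x (true ∷ p)  (suc x) (there x∈p-x) = x∉p-x p x x∈p-x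
x∉p-x (false ∷ p) (suc x) (there x∈p-x) = x∉p-x p x x∈p-x

x∈p-y⇒x≢y : ∀ {n} {p : Subset n} {x y} → x ∈ p - y → x ≢ y
x∈p-y⇒x≢y {p = p} x∈p-x refl = x∉p-x p _ x∈p-x

p-x⊆p : ∀ {n} {p : Subset n} {x} → p - x ⊆ p
p-x⊆p {p = p} {x} = p─q⊆p p ⁅ x ⁆

x∈p⇒∣p∣≡1+∣p-x∣ : ∀ {n} {p : Subset n} {x} → x ∈ p → ∣ p ∣ ≡ suc ∣ p - x ∣
x∈p⇒∣p∣≡1+∣p-x∣ {p = true ∷ p}  here          = cong (suc ∘ ∣_∣) (sym (p─⊥≡p p))
x∈p⇒∣p∣≡1+∣p-x∣ {p = true ∷ p}  (there x∈p) = cong suc (x∈p⇒∣p∣≡1+∣p-x∣ x∈p)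
x∈p⇒∣p∣≡1+∣p-x∣ {p = false ∷ p} (there x∈p) = x∈p⇒∣p∣≡1+∣p-x∣ x∈p

2∤∣p∣⇒2∣∣p-x∣ : ∀ {n} {p : Subset n} {x} → x ∈ p → 2 ∤ ∣ p ∣ → 2 ∣ ∣ p - x ∣
2∤∣p∣⇒2∣∣p-x∣ x∈p odd = 2∤1+n⇒2∣n (subst (2 ∤_) (x∈p⇒∣p∣≡1+∣p-x∣ x∈p) odd)

2∣∣p∣⇒2∤∣p-x∣ : ∀ {n} {p : Subset n} {x} → x ∈ p → 2 ∣ ∣ p ∣ → 2 ∤ ∣ p - x ∣
2∣∣p∣⇒2∤∣p-x∣ x∈p even = 2∣1+n⇒2∤n (subst (2 ∣_) (x∈p⇒∣p∣≡1+∣p-x∣ x∈p) even)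

Empty⇒2∣∣p∣ : ∀ {n} {p : Subset n} → Empty p → 2 ∣ ∣ p ∣
Empty⇒2∣∣p∣ {n} empty = subst (2 ∣_) (sym (trans (cong ∣_∣ (Empty-unique empty)) (∣⊥∣≡0 n))) (2 ∣0)

all-moves-winning⇒¬Win : ∀ {n} {G : Graph n} {S} →
  (∀ v → v ∈ S → Win G (move G S v)) → ¬ Win G S
all-moves-winning⇒¬Win winning (win v v∈S reply) with winning v v∈S
... | win w w∈ reply′ = all-moves-winning⇒¬Win reply′ (reply w w∈)

module Multipartite {n} (G : Graph n) (part : Fin n → ℕ)
  (adj≡ : ∀ u v → adj G u v ≡ not (does (part u ≟ part v))) where

  IsPartner : Subset n → Fin n → Fin n → Set
  IsPartner S x y = y ∈ S × y ≢ x × part y ≡ part x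

  Partner : Subset n → Fin n → Set
  Partner S x = ∃ (IsPartner S x)

  TwoPartners : Subset n → Fin n → Set
  TwoPartners S x = ∃ λ y → IsPartner S x y × Partner (S - y) x

  UniquePartners : Subset n → Set
  UniquePartners S = ∀ {x y z} → x ∈ S → IsPartner S x y → IsPartner S x z → y ≡ z

  Paired : Subset n → Set
  Paired S = ∀ {x} → x ∈ S → Partner S x

  PairedExcept : Fin n → Subset n → Set
  PairedExcept e S = ∀ {x} → x ∈ S → x ≢ e → Partner S x

  TwoParts : Subset n → Set
  TwoParts S = ∃ λ u → ∃ λ w → u ∈ S × w ∈ S × part u ≢ part w

  Balanced : Subset n → Set
  Balanced S = TwoParts S × Paired S

  IsPartner? : ∀ S x y → Dec (IsPartner S x y)
  IsPartner? S x y = y ∈? S ×-dec ¬? (y ≟ᶠ x) ×-dec (part y ≟ part x)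

  Partner? : ∀ S x → Dec (Partner S x)
  Partner? S x = any? (IsPartner? S x)

  TwoPartners? : ∀ S x → Dec (TwoPartners S x)
  TwoPartners? S x = any? λ y → IsPartner? S x y ×-dec Partner? (S - y) x

  TwoParts? : ∀ S → Dec (TwoParts S)
  TwoParts? S = any? λ u → any? λ w → u ∈? S ×-dec w ∈? S ×-dec ¬? (part u ≟ part w)

  adj-≡true : ∀ {u v} → part u ≢ part v → adj G u v ≡ true
  adj-≡true {u} {v} u≁v = trans (adj≡ u v) (cong not (dec-false (part u ≟ part v) u≁v))

  adj-≡true⁻¹ : ∀ {u v} → adj G u v ≡ true → part u ≢ part v
  adj-≡true⁻¹ {u} {v} u~v u≡v
    with () ← trans (sym u~v) (trans (adj≡ u v) (cong not (dec-true (part u ≟ part v) u≡v)))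

  hasNbr-≡true : ∀ {S u v} → u ∈ S → part v ≢ part u → hasNbr G S v ≡ true
  hasNbr-≡true {S} {u} {v} u∈S v≁u =
    dec-true (any? _) (u , cong₂ _∧_ ([]=⇒lookup u∈S) (adj-≡true v≁u))

  hasNbr-≡true⁻¹ : ∀ {S v} → hasNbr G S v ≡ true → ∃ λ u → u ∈ S × part v ≢ part u
  hasNbr-≡true⁻¹ {S} {v} h with does≡true⇒ (any? _) h
  ... | u , edge =
    u , lookup⇒[]= u S (∧-conicalˡ _ _ edge) , adj-≡true⁻¹ (∧-conicalʳ (mem S u) _ edge)

  clean-TwoParts : ∀ {S} → TwoParts S → clean G S ≡ S
  clean-TwoParts {S} (u , w , u∈S , w∈S , u≁w) = begin
    tabulate (λ v → mem S v ∧ hasNbr G S v) ≡⟨ tabulate-cong kept ⟩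
    tabulate (mem S)                        ≡⟨ tabulate∘lookup S ⟩
    S                                       ∎
    where
    open ≡-Reasoning
    kept : ∀ v → mem S v ∧ hasNbr G S v ≡ mem S v
    kept v with mem S v
    ... | false = refl
    ... | true with part v ≟ part u
    ...   | yes v≡u = hasNbr-≡true w∈S (u≁w ∘ trans (sym v≡u))
    ...   | no  v≁u = hasNbr-≡true u∈S v≁u

  clean-¬TwoParts : ∀ {S} → ¬ TwoParts S → Empty (clean G S)
  clean-¬TwoParts {S} ¬two (x , x∈clean) =
    let u , u∈S , x≁u = hasNbr-≡true⁻¹ (∧-conicalʳ (mem S x) _ kept) in
    ¬two (x , u , lookup⇒[]= x S (∧-conicalˡ _ _ kept) , u∈S , x≁u)
    where
    kept : mem S x ∧ hasNbr G S x ≡ true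
    kept = trans (sym (lookup∘tabulate _ x)) ([]=⇒lookup x∈clean)

  IsPartner-minus : ∀ {S x y v} → IsPartner S x y → y ≢ v → IsPartner (S - v) x y
  IsPartner-minus (y∈S , y≢x , y~x) y≢v = x∈p∧x≢y⇒x∈p-y y∈S y≢v , y≢x , y~x

  IsPartner-via : ∀ {S v x y} → IsPartner S v y → part v ≡ part x → y ≢ x → IsPartner S x y
  IsPartner-via (y∈S , _ , y~v) v~x y≢x = y∈S , y≢x , trans y~v v~x

  TwoParts-minus : ∀ {S v} → Partner S v → TwoParts S → TwoParts (S - v)
  TwoParts-minus {v = v} (p , p∈S , p≢v , p~v) (u , w , u∈S , w∈S , u≁w)
    with u ≟ᶠ v | w ≟ᶠ v
  ... | yes refl | yes refl = ⊥-elim (u≁w refl)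
  ... | yes refl | no w≢v   = p , w , p∈S-v , x∈p∧x≢y⇒x∈p-y w∈S w≢v , u≁w ∘ trans (sym p~v)
    where p∈S-v = x∈p∧x≢y⇒x∈p-y p∈S p≢v
  ... | no u≢v   | yes refl = u , p , x∈p∧x≢y⇒x∈p-y u∈S u≢v , p∈S-v , λ u~p → u≁w (trans u~p p~v)
    where p∈S-v = x∈p∧x≢y⇒x∈p-y p∈S p≢v
  ... | no u≢v   | no w≢v   = u , w , x∈p∧x≢y⇒x∈p-y u∈S u≢v , x∈p∧x≢y⇒x∈p-y w∈S w≢v , u≁w

  Paired-minus : ∀ {S v p} → Paired S → IsPartner S v p → PairedExcept p (S - v)
  Paired-minus {v = v} {p} paired v~p@(_ , p≢v , _) x∈S-v x≢p with paired (p-x⊆p x∈S-v)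
  ... | y , x~y@(_ , _ , y~x) with y ≟ᶠ v
  ...   | no y≢v   = y , IsPartner-minus x~y y≢v
  ...   | yes refl = p , IsPartner-minus (IsPartner-via v~p y~x (x≢p ∘ sym)) p≢v

  PairedExcept-minus : ∀ {S e} → PairedExcept e S → ¬ Partner S e → Paired (S - e)
  PairedExcept-minus {e = e} near ¬partner {x} x∈S-e with near (p-x⊆p x∈S-e) (x∈p-y⇒x≢y x∈S-e)
  ... | y , x~y@(_ , _ , y~x) with y ≟ᶠ e
  ...   | no y≢e   = y , IsPartner-minus x~y y≢e
  ...   | yes refl = ⊥-elim (¬partner (x , p-x⊆p x∈S-e , x∈p-y⇒x≢y x∈S-e , sym y~x))

  TwoPartners-minus : ∀ {S v} → Paired S → TwoPartners S v → Paired (S - v)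
  TwoPartners-minus {v = v} paired (a , v~a@(_ , a≢v , _) , b , b∈S-a , b≢v , b~v) {x} x∈S-v
    with paired (p-x⊆p x∈S-v)
  ... | y , x~y@(_ , _ , y~x) with y ≟ᶠ v
  ...   | no y≢v = y , IsPartner-minus x~y y≢v
  ...   | yes refl with a ≟ᶠ x
  ...     | no a≢x   = a , IsPartner-minus (IsPartner-via v~a y~x a≢x) a≢v
  ...     | yes refl = b , IsPartner-minus (IsPartner-via v~b y~x (x∈p-y⇒x≢y b∈S-a)) b≢v
    where v~b = p-x⊆p b∈S-a , b≢v , b~v

  UniquePartners-minus : ∀ {S v} → UniquePartners S → UniquePartners (S - v)
  UniquePartners-minus unique x∈S-v (y∈ , x~y) (z∈ , x~z) =
    unique (p-x⊆p x∈S-v) (p-x⊆p y∈ , x~y) (p-x⊆p z∈ , x~z)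

  Paired∧UniquePartners⇒even : ∀ {S} → Acc _<_ ∣ S ∣ → Paired S → UniquePartners S → 2 ∣ ∣ S ∣
  Paired∧UniquePartners⇒even {S} (acc rs) paired unique with nonempty? S
  ... | no empty = Empty⇒2∣∣p∣ empty
  ... | yes (x , x∈S) with paired x∈S
  ...   | p , x~p@(p∈S , p≢x , p~x) = subst (2 ∣_) (sym size) (∣m∣n⇒∣m+n ∣-refl even′)
    where
    p∈S-x = x∈p∧x≢y⇒x∈p-y p∈S p≢x
    size : ∣ S ∣ ≡ 2 + ∣ S - x - p ∣
    size = trans (x∈p⇒∣p∣≡1+∣p-x∣ x∈S) (cong suc (x∈p⇒∣p∣≡1+∣p-x∣ p∈S-x))
    not-partner : ∀ {y} → y ∈ S - x - p → part y ≢ part x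
    not-partner y∈ y~x =
      x∈p-y⇒x≢y y∈ (unique x∈S (p-x⊆p (p-x⊆p y∈) , x∈p-y⇒x≢y (p-x⊆p y∈) , y~x) x~p)
    paired′ : Paired (S - x - p)
    paired′ {y} y∈ with paired (p-x⊆p (p-x⊆p y∈))
    ... | q , q∈S , q≢y , q~y with q ≟ᶠ x | q ≟ᶠ p
    ...   | yes refl | _        = ⊥-elim (not-partner y∈ (sym q~y))
    ...   | no _     | yes refl = ⊥-elim (not-partner y∈ (trans (sym q~y) p~x))
    ...   | no q≢x   | no q≢p   = q , x∈p∧x≢y⇒x∈p-y (x∈p∧x≢y⇒x∈p-y q∈S q≢x) q≢p , q≢y , q~y
    even′ : 2 ∣ ∣ S - x - p ∣
    even′ = Paired∧UniquePartners⇒even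
      (rs (<-trans (x∈p⇒∣p-x∣<∣p∣ p∈S-x) (x∈p⇒∣p-x∣<∣p∣ x∈S)))
      paired′ (UniquePartners-minus (UniquePartners-minus unique))

  odd-Paired⇒TwoPartners : ∀ {S} → Paired S → 2 ∤ ∣ S ∣ → ∃ λ v → v ∈ S × TwoPartners S v
  odd-Paired⇒TwoPartners {S} paired odd with any? (λ v → v ∈? S ×-dec TwoPartners? S v)
  ... | yes found = found
  ... | no none = ⊥-elim (odd (Paired∧UniquePartners⇒even (<-wellFounded _) paired unique))
    where
    unique : UniquePartners S
    unique {x} {y} {z} x∈S x~y x~z with y ≟ᶠ z
    ... | yes y≡z = y≡z
    ... | no y≢z = ⊥-elim (none (x , x∈S , y , x~y , z , IsPartner-minus x~z (y≢z ∘ sym)))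

  odd-Paired⇒move-to-Paired : ∀ {S} → Paired S → 2 ∤ ∣ S ∣ → ∃ λ v → v ∈ S × Paired (S - v)
  odd-Paired⇒move-to-Paired paired odd =
    let v , v∈S , two = odd-Paired⇒TwoPartners paired odd in v , v∈S , TwoPartners-minus paired two

  PairedExcept⇒Paired : ∀ {S e} → PairedExcept e S → (e ∈ S → Partner S e) → Paired S
  PairedExcept⇒Paired {e = e} near partner {x} x∈S with x ≟ᶠ e
  ... | yes refl = partner x∈S
  ... | no x≢e   = near x∈S x≢e

  odd-PairedExcept⇒move-to-Paired : ∀ {S e} → PairedExcept e S → 2 ∤ ∣ S ∣ →
    ∃ λ v → v ∈ S × Paired (S - v)
  odd-PairedExcept⇒move-to-Paired {S} {e} near odd with e ∈? S | Partner? S e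
  ... | yes e∈S | no ¬partner = e , e∈S , PairedExcept-minus near ¬partner
  ... | yes _   | yes partner = odd-Paired⇒move-to-Paired (PairedExcept⇒Paired near (λ _ → partner)) odd
  ... | no e∉S  | _           = odd-Paired⇒move-to-Paired (PairedExcept⇒Paired near (⊥-elim ∘ e∉S)) odd

  mutual
    odd-PairedExcept-wins : ∀ {S e} → Acc _<_ ∣ S ∣ → PairedExcept e S → 2 ∤ ∣ S ∣ → Win G S
    odd-PairedExcept-wins {S} (acc rs) near odd with odd-PairedExcept⇒move-to-Paired near odd
    ... | v , v∈S , paired with TwoParts? (S - v)
    ... | no ¬two = win v v∈S λ w w∈ → ⊥-elim (clean-¬TwoParts ¬two (w , w∈))
    ... | yes two = win v v∈S (subst (λ T → ∀ w → w ∈ T → Win G (move G T w))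
      (sym (clean-TwoParts two))
      (even-Balanced-moves-win (rs (x∈p⇒∣p-x∣<∣p∣ v∈S)) (two , paired) (2∤∣p∣⇒2∣∣p-x∣ v∈S odd)))

    even-Balanced-moves-win : ∀ {S} → Acc _<_ ∣ S ∣ → Balanced S → 2 ∣ ∣ S ∣ →
      ∀ v → v ∈ S → Win G (move G S v)
    even-Balanced-moves-win (acc rs) (two , paired) even v v∈S =
      let p , v~p = paired v∈S in
      subst (Win G) (sym (clean-TwoParts (TwoParts-minus (p , v~p) two)))
        (odd-PairedExcept-wins (rs (x∈p⇒∣p-x∣<∣p∣ v∈S)) (Paired-minus paired v~p)
          (2∣∣p∣⇒2∤∣p-x∣ v∈S even))

  odd-Paired-wins : ∀ {S} → Paired S → 2 ∤ ∣ S ∣ → Win G S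
  odd-Paired-wins {S} paired odd with nonempty? S
  ... | yes (e , _) = odd-PairedExcept-wins {e = e} (<-wellFounded _) (λ x∈S _ → paired x∈S) odd
  ... | no empty    = ⊥-elim (odd (Empty⇒2∣∣p∣ empty))

  even-Balanced-loses : ∀ {S} → Balanced S → 2 ∣ ∣ S ∣ → ¬ Win G S
  even-Balanced-loses balanced even =
    all-moves-winning⇒¬Win (even-Balanced-moves-win (<-wellFounded _) balanced even)

HasTwin : (L : List ℕ) → Fin (length L) → Set
HasTwin L x = ∃ λ y → y ≢ x × lookup L y ≡ lookup L x

Twinned : List ℕ → Set
Twinned L = ∀ x → HasTwin L x

TwinnedApartFrom : ℕ → List ℕ → Set
TwinnedApartFrom c L = ∀ x → lookup L x ≡ c ⊎ HasTwin L x

HasTwin-∷ : ∀ {c L x} → HasTwin L x → HasTwin (c ∷ L) (suc x)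
HasTwin-∷ (y , y≢x , y~x) = suc y , y≢x ∘ suc-injective , y~x

∷-twinnedApartFrom : ∀ {c L} → TwinnedApartFrom c L → TwinnedApartFrom c (c ∷ L)
∷-twinnedApartFrom twinned zero    = inj₁ refl
∷-twinnedApartFrom twinned (suc x) with twinned x
... | inj₁ x≡c = inj₁ x≡c
... | inj₂ twin = inj₂ (HasTwin-∷ twin)

replicate-++-twinnedApartFrom : ∀ m {c L} →
  TwinnedApartFrom c L → TwinnedApartFrom c (replicate m c ++ L)
replicate-++-twinnedApartFrom zero    twinned = twinned
replicate-++-twinnedApartFrom (suc m) twinned =
  ∷-twinnedApartFrom (replicate-++-twinnedApartFrom m twinned)

∷∷-twinned : ∀ {c L} → TwinnedApartFrom c L → Twinned (c ∷ c ∷ L)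
∷∷-twinned twinned zero          = suc zero , (λ ()) , refl
∷∷-twinned twinned (suc zero)    = zero , (λ ()) , refl
∷∷-twinned twinned (suc (suc x)) with twinned x
... | inj₁ x≡c  = zero , (λ ()) , sym x≡c
... | inj₂ twin = HasTwin-∷ (HasTwin-∷ twin)

labelsFrom-twinned : ∀ i {ns} → All (2 ≤_) ns → Twinned (labelsFrom i ns)
labelsFrom-twinned i [] ()
labelsFrom-twinned i {suc (suc m) ∷ ms} (s≤s (s≤s _) ∷ ms≥2) =
  ∷∷-twinned (replicate-++-twinnedApartFrom m (inj₂ ∘ labelsFrom-twinned (suc i) ms≥2))

length-labelsFrom : ∀ i ns → length (labelsFrom i ns) ≡ sum ns
length-labelsFrom i []       = refl
length-labelsFrom i (m ∷ ms) =
  trans (length-++ (replicate m i)) (cong₂ _+_ (length-replicate m) (length-labelsFrom (suc i) ms))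

module CompleteMultipartiteGrim (ns : List ℕ) where

  open Multipartite (CompleteMultipartite ns) (lookup (labels ns)) (λ _ _ → refl) public

  ∣⊤∣≡sum : ∣ ⊤ {numVertices ns} ∣ ≡ sum ns
  ∣⊤∣≡sum = trans (∣⊤∣≡n (numVertices ns)) (length-labelsFrom 0 ns)

  ⊤-Paired : All (2 ≤_) ns → Paired ⊤
  ⊤-Paired ns≥2 {x} _ = let y , y≢x , y~x = labelsFrom-twinned 0 ns≥2 x in y , ∈⊤ , y≢x , y~x

⊤-TwoParts : ∀ a b ms → CompleteMultipartiteGrim.TwoParts (suc a ∷ suc b ∷ ms) ⊤
⊤-TwoParts a b ms = index in-part₀ , index in-part₁ , ∈⊤ , ∈⊤ , λ 0≡1 →
  0≢1+n (trans (sym (lookup-index in-part₀)) (trans 0≡1 (lookup-index in-part₁)))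
  where
  in-part₀ : Any (_≡ 0) (labels (suc a ∷ suc b ∷ ms))
  in-part₀ = here refl
  in-part₁ : Any (_≡ 1) (labels (suc a ∷ suc b ∷ ms))
  in-part₁ = ++⁺ʳ (replicate (suc a) 0) (here refl)

theorem3p4 : (ns : List ℕ) → 2 < length ns → All (2 ≤_) ns →
    (IsP (CompleteMultipartite ns) ⇔ 2 ∣ sum ns)
theorem3p4 []                      ()       _
theorem3p4 (_ ∷ [])                (s≤s ()) _
theorem3p4 (zero ∷ _)              _        (() ∷ _)
theorem3p4 (_ ∷ zero ∷ _)          _        (_ ∷ () ∷ _)
-- Two nonempty parts suffice.
theorem3p4 ns@(suc a ∷ suc b ∷ ms) _        ns≥2 = mk⇔ P⇒even even⇒P
  where
  open CompleteMultipartiteGrim ns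
  balanced : Balanced ⊤
  balanced = ⊤-TwoParts a b ms , ⊤-Paired ns≥2
  start≡⊤ : start (CompleteMultipartite ns) ≡ ⊤
  start≡⊤ = clean-TwoParts (proj₁ balanced)
  even⇒P : 2 ∣ sum ns → IsP (CompleteMultipartite ns)
  even⇒P even =
    even-Balanced-loses balanced (subst (2 ∣_) (sym ∣⊤∣≡sum) even) ∘ subst (Win _) start≡⊤
  P⇒even : IsP (CompleteMultipartite ns) → 2 ∣ sum ns
  P⇒even isP = decidable-stable (2 ∣? sum ns) λ odd →
    isP (subst (Win _) (sym start≡⊤)
      (odd-Paired-wins (proj₂ balanced) (odd ∘ subst (2 ∣_) ∣⊤∣≡sum)))
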